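{- Let $i$ and $j$ be integers with $9\le i<j$. Then every graph switching equivalent to the cycle $C_j$ is $\mathcal{S}(C_i)$-free.
   Context: All graphs are finite and simple. For a graph $G$ and $A\subseteq V(G)$, the switching $S(G,A)$ is the graph on $V(G)$ whose edges are the edges of $G$ with both ends in $A$, the edges of $G$ with both ends outside $A$, and all pairs $uv$ with $u\in A$, $v\notin A$, $uv\notin E(G)$. Two graphs are switching equivalent if one is isomorphic to $S(G,A)$ for the other graph $G$ and some $A$. $\mathcal{S}(H)$ denotes the set of graphs switching equivalent to $H$, and a graph is $\mathcal{S}(H)$-free if it has no induced subgraph isomorphic to a graph in $\mathcal{S}(H)$. $C_\ell$ is the cycle on $\ell$ vertices. -}

module Defs where

open import Data.Nat using (ℕ; zero; suc)
open import Data.Nat.Properties using () renaming (_≟_ to _≟ℕ_)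
open import Data.Fin using (Fin; toℕ; _≟_)
open import Data.Bool using (Bool; true; false; not; _∧_; _∨_; _xor_)
open import Data.Bool.Properties using (xor-same; xor-comm; ∨-comm)
open import Data.Product using (Σ; _×_; _,_)
open import Function.Bundles using (_↔_; Inverse)
open import Function.Definitions using (Injective)
open import Relation.Nullary using (¬_; does)
open import Relation.Nullary.Decidable using (dec-true)
open import Relation.Binary.PropositionalEquality using (_≡_; refl; sym; cong; cong₂; trans)

record Graph (n : ℕ) : Set where
  field
    adj    : Fin n → Fin n → Bool
    adj-sym    : ∀ u v → adj u v ≡ adj v u
    adj-irrefl : ∀ v → adj v v ≡ false
open Graph public

-- Switching S(G,A), with A ⊆ V(G) given by its characteristic function:
-- a pair uv keeps its status iff both ends are on the same side of A,
-- and is toggled iff exactly one end lies in A.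
switch : ∀ {n} → Graph n → (Fin n → Bool) → Graph n
switch G A = record
  { adj = λ u v → adj G u v xor (A u xor A v)
  ; adj-sym = λ u v → cong₂ _xor_ (adj-sym G u v) (xor-comm (A u) (A v))
  ; adj-irrefl = λ v → trans (cong (adj G v v xor_) (xor-same (A v)))
                             (trans (cong (_xor false) (adj-irrefl G v)) refl)
  }

_≅_ : ∀ {n m} → Graph n → Graph m → Set
_≅_ {n} {m} G H = Σ (Fin n ↔ Fin m) λ f →
  ∀ u v → adj H (Inverse.to f u) (Inverse.to f v) ≡ adj G u v

SwitchingEquivalent : ∀ {n m} → Graph n → Graph m → Set
SwitchingEquivalent {n} H K = Σ (Fin n → Bool) λ A → switch H A ≅ K

HasInduced : ∀ {n k} → Graph n → Graph k → Set
HasInduced {n} {k} G H = Σ (Fin k → Fin n) λ f →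
  Injective _≡_ _≡_ f × (∀ u v → adj G (f u) (f v) ≡ adj H u v)

SFree : ∀ {n m} → Graph m → Graph n → Set
SFree H G = ∀ k (K : Graph k) → SwitchingEquivalent H K → ¬ HasInduced G K

-- The cycle C_n on Fin n (vertices 0,1,…,n-1, u ~ u+1 and n-1 ~ 0).
-- For n ≥ 3 this is the cycle graph; only n ≥ 9 is used.
cycStep : ∀ {n} → Fin n → Fin n → Bool
cycStep {n} u v = does (suc (toℕ u) ≟ℕ toℕ v)
                ∨ (does (toℕ u ≟ℕ 0) ∧ does (suc (toℕ v) ≟ℕ n))

cycAdj : ∀ {n} → Fin n → Fin n → Bool
cycAdj u v = not (does (u ≟ v)) ∧ (cycStep u v ∨ cycStep v u)

private
  does-sym : ∀ {n} (u v : Fin n) → does (u ≟ v) ≡ does (v ≟ u)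
  does-sym u v with u ≟ v | v ≟ u
  ... | Relation.Nullary.yes _ | Relation.Nullary.yes _ = refl
  ... | Relation.Nullary.no _  | Relation.Nullary.no _  = refl
  ... | Relation.Nullary.yes p | Relation.Nullary.no q = Data.Empty.⊥-elim (q (sym p))
    where import Data.Empty
  ... | Relation.Nullary.no p  | Relation.Nullary.yes q = Data.Empty.⊥-elim (p (sym q))
    where import Data.Empty

  does-refl : ∀ {n} (v : Fin n) → does (v ≟ v) ≡ true
  does-refl v with v ≟ v
  ... | Relation.Nullary.yes _ = refl
  ... | Relation.Nullary.no ¬p = Data.Empty.⊥-elim (¬p refl)
    where import Data.Empty

Cycle : (n : ℕ) → Graph n
Cycle n = record
  { adj = cycAdj
  ; adj-sym = λ u v → cong₂ _∧_ (cong not (does-sym u v)) (∨-comm (cycStep u v) (cycStep v u))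
  ; adj-irrefl = λ v → cong (λ b → not b ∧ (cycStep v v ∨ cycStep v v)) (does-refl v)
  }

{-# OPTIONS --safe #-}
-- Undoing the switchings on both sides (switching is an involution, and switchings compose by
-- xor-ing the switched sets), some switching S(C_i, c) of C_i is an induced subgraph of C_j.
-- If c is constant this is C_i itself; every vertex of C_i has two neighbours, so the image of
-- C_i is closed under the successor of C_j and hence is all of C_j, contradicting i < j.
-- Otherwise pick u, w with c u ≠ c w. Every vertex v is coloured differently from u or from w,
-- and is then adjacent to that vertex either in C_i or, through the embedding, in C_j. Cycles
-- have maximum degree 2, so this covers at most 2 · (2 + 2) = 8 vertices, contradicting 9 ≤ i.
module Submission where

open import Defs
open import Data.Nat using (ℕ; zero; suc; _+_; _≤_; _<_; z≤n; s≤s)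
open import Data.Nat.Properties
  using (≡ᵇ⇒≡; ≡⇒≡ᵇ; ≤⇒≯; ≤-trans; <⇒≤; <-irrefl; <-trans; n<1+n; 1+n≢n; suc-injective)
  renaming (_≟_ to _≟ℕ_)
open import Data.Fin using (Fin; toℕ; fromℕ; inject₁; join; splitAt) renaming (zero to fzero; suc to fsuc)
open import Data.Fin.Properties
  using (_≟_; toℕ-injective; toℕ<n; toℕ-fromℕ; toℕ-inject₁; ≤fromℕ; splitAt-join; injective⇒≤; all?; ¬∀⟶∃¬)
open import Data.Fin.Induction using (<-weakInduction; <-weakInduction-startingFrom)
open import Data.Bool using (Bool; true; false; T; not; _∨_; _xor_)
open import Data.Bool.Properties
  using (T-≡; T-not-≡; T-∧; T-∨; xor-same; xor-assoc; xor-identityʳ; xor-∧-commutativeRing)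
  renaming (_≟_ to _≟𝔹_)
open import Data.Product using (Σ-syntax; ∃; _×_; _,_; proj₁; proj₂)
open import Data.Sum using (_⊎_; inj₁; inj₂)
import Data.Sum as Sum
open import Data.Sum.Properties using (inj₁-injective; inj₂-injective)
open import Data.Empty using (⊥; ⊥-elim)
open import Level using (Level; 0ℓ)
open import Algebra.Bundles using (CommutativeRing)
open import Algebra.Properties.CommutativeSemigroup
  (CommutativeRing.+-commutativeSemigroup xor-∧-commutativeRing) using (interchange)
open import Function using (_∘_; Equivalence)
open import Function.Bundles using (Inverse; Injection)
open import Function.Definitions using (Injective)
open import Function.Properties.Inverse using (↔-sym; ↔⇒↣)
open import Relation.Nullary using (¬_; yes; no; does)
open import Relation.Nullary.Decidable using (dec-false)
open import Relation.Unary using (Pred; _∪_; _⊆_; Universal)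
open import Relation.Binary.PropositionalEquality
  using (_≡_; _≢_; refl; sym; trans; cong; cong₂; module ≡-Reasoning)

private
  variable
    ℓ : Level
    k l m n : ℕ

record AtMost (k : ℕ) (P : Pred (Fin n) 0ℓ) : Set where
  field
    tag           : ∀ v → P v → Fin k
    tag-injective : ∀ {v w} (p : P v) (q : P w) → tag v p ≡ tag w q → v ≡ w
open AtMost

AtMost-1 : {P : Pred (Fin n) 0ℓ} → (∀ {v w} → P v → P w → v ≡ w) → AtMost 1 P
AtMost-1 unique = record { tag = λ _ _ → fzero ; tag-injective = λ p q _ → unique p q }

AtMost-⊆ : {P Q : Pred (Fin n) 0ℓ} → Q ⊆ P → AtMost k P → AtMost k Q
AtMost-⊆ Q⊆P P≤k = record
  { tag = λ v → tag P≤k v ∘ Q⊆P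
  ; tag-injective = λ p q → tag-injective P≤k (Q⊆P p) (Q⊆P q)
  }

AtMost-∪ : {P Q : Pred (Fin n) 0ℓ} → AtMost k P → AtMost l Q → AtMost (k + l) (P ∪ Q)
AtMost-∪ {k = k} {l = l} {P = P} {Q} P≤k Q≤l = record
  { tag = λ v → join k l ∘ tags v
  ; tag-injective = λ p q eq → tags-injective p q (begin
      tags _ p                        ≡⟨ splitAt-join k l (tags _ p) ⟨
      splitAt k (join k l (tags _ p)) ≡⟨ cong (splitAt k) eq ⟩
      splitAt k (join k l (tags _ q)) ≡⟨ splitAt-join k l (tags _ q) ⟩
      tags _ q                        ∎)
  }
  where
  open ≡-Reasoning
  tags : ∀ v → (P ∪ Q) v → Fin k ⊎ Fin l
  tags v = Sum.map (tag P≤k v) (tag Q≤l v)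
  tags-injective : ∀ {v w} (p : (P ∪ Q) v) (q : (P ∪ Q) w) → tags v p ≡ tags w q → v ≡ w
  tags-injective (inj₁ p) (inj₁ q) eq = tag-injective P≤k p q (inj₁-injective eq)
  tags-injective (inj₂ p) (inj₂ q) eq = tag-injective Q≤l p q (inj₂-injective eq)
  tags-injective (inj₁ _) (inj₂ _) ()
  tags-injective (inj₂ _) (inj₁ _) ()

AtMost-Universal⇒≤ : {P : Pred (Fin n) 0ℓ} → Universal P → AtMost k P → n ≤ k
AtMost-Universal⇒≤ all P≤k = injective⇒≤ λ {v} {w} → tag-injective P≤k (all v) (all w)

AtMost-preimage : {P : Pred (Fin n) 0ℓ} (h : Fin m → Fin n) → Injective _≡_ _≡_ h →
                  AtMost k P → AtMost k (P ∘ h)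
AtMost-preimage h h-inj P≤k = record
  { tag = λ v → tag P≤k (h v)
  ; tag-injective = λ p q → h-inj ∘ tag-injective P≤k p q
  }

MaxDegreeAtMost : Graph n → ℕ → Set
MaxDegreeAtMost G d = ∀ u → AtMost d (λ v → adj G u v ≡ true)

HasInduced-trans : ∀ (G : Graph n) (H : Graph m) (K : Graph k) →
                   HasInduced G H → HasInduced H K → HasInduced G K
HasInduced-trans _ _ _ (f , f-inj , f-adj) (g , g-inj , g-adj) =
  f ∘ g , g-inj ∘ f-inj , λ u v → trans (f-adj (g u) (g v)) (g-adj u v)

≅⇒HasInduced : ∀ (G : Graph n) (H : Graph m) → G ≅ H → HasInduced H G
≅⇒HasInduced _ _ (φ , φ-adj) = Inverse.to φ , Injection.injective (↔⇒↣ φ) , φ-adj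

≅-sym : ∀ (G : Graph n) (H : Graph m) → G ≅ H → H ≅ G
≅-sym _ H (φ , φ-adj) = ↔-sym φ , λ u v →
  trans (sym (φ-adj _ _)) (cong₂ (adj H) (Inverse.strictlyInverseˡ φ u) (Inverse.strictlyInverseˡ φ v))

switch-constant : ∀ (G : Graph n) {c : Fin n → Bool} {b} → (∀ v → c v ≡ b) →
                  ∀ u v → adj (switch G c) u v ≡ adj G u v
switch-constant G {c} {b} c≡b u v = begin
  adj G u v xor (c u xor c v) ≡⟨ cong (adj G u v xor_) (cong₂ _xor_ (c≡b u) (c≡b v)) ⟩
  adj G u v xor (b xor b)     ≡⟨ cong (adj G u v xor_) (xor-same b) ⟩
  adj G u v xor false         ≡⟨ xor-identityʳ (adj G u v) ⟩
  adj G u v                   ∎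
  where open ≡-Reasoning

HasInduced-switch-constant : ∀ (G : Graph n) (H : Graph k) {c : Fin k → Bool} {b} →
                             (∀ v → c v ≡ b) → HasInduced G (switch H c) → HasInduced G H
HasInduced-switch-constant _ H c≡b (f , f-inj , f-adj) =
  f , f-inj , λ u v → trans (f-adj u v) (switch-constant H c≡b u v)

unswitch-HasInduced : ∀ (G : Graph n) (H : Graph k) (A : Fin n → Bool) (B : Fin k → Bool) →
                      HasInduced (switch G A) (switch H B) →
                      Σ[ c ∈ (Fin k → Bool) ] HasInduced G (switch H c)
unswitch-HasInduced G H A B (f , f-inj , f-adj) =
  (λ u → B u xor A (f u)) , f , f-inj , adj-unswitched
  where
  open ≡-Reasoning
  adj-unswitched : ∀ u v →
                   adj G (f u) (f v) ≡ adj H u v xor ((B u xor A (f u)) xor (B v xor A (f v)))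
  adj-unswitched u v = begin
    x                                               ≡⟨ xor-identityʳ x ⟨
    x xor false                                     ≡⟨ cong (x xor_) (xor-same a) ⟨
    x xor (a xor a)                                 ≡⟨ xor-assoc x a a ⟨
    (x xor a) xor a                                 ≡⟨ cong (_xor a) (f-adj u v) ⟩
    (y xor b) xor a                                 ≡⟨ xor-assoc y b a ⟩
    y xor (b xor a)                                 ≡⟨ cong (y xor_) (interchange (B u) (B v) (A (f u)) (A (f v))) ⟩
    y xor ((B u xor A (f u)) xor (B v xor A (f v))) ∎
    where
    x = adj G (f u) (f v)
    y = adj H u v
    a = A (f u) xor A (f v)
    b = B u xor B v

SwitchingEquivalent-HasInduced : ∀ (G : Graph n) (G′ : Graph m) (H : Graph k) (H′ : Graph l) →
                                 SwitchingEquivalent G G′ → SwitchingEquivalent H H′ →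
                                 HasInduced G′ H′ → Σ[ c ∈ (Fin k → Bool) ] HasInduced G (switch H c)
SwitchingEquivalent-HasInduced G G′ H H′ (A , SGA≅G′) (B , SHB≅H′) G′⊇H′ =
  unswitch-HasInduced G H A B
    (HasInduced-trans (switch G A) G′ (switch H B)
      (≅⇒HasInduced G′ (switch G A) (≅-sym (switch G A) G′ SGA≅G′))
      (HasInduced-trans G′ H′ (switch H B) G′⊇H′ (≅⇒HasInduced (switch H B) H′ SHB≅H′)))

constant-or-nonconstant : (c : Fin (suc n) → Bool) → (∀ v → c v ≡ c fzero) ⊎ ∃ λ w → c w ≢ c fzero
constant-or-nonconstant c with all? (λ v → c v ≟𝔹 c fzero)
... | yes constant    = inj₁ constant
... | no nonconstant = inj₂ (¬∀⟶∃¬ _ _ (λ v → c v ≟𝔹 c fzero) nonconstant)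

xor-≢-either : ∀ a {b x y} → x ≢ y → b ≡ a xor (x xor y) → a ≡ true ⊎ b ≡ true
xor-≢-either true                      _   _ = inj₁ refl
xor-≢-either false {x = false} {false} x≢y _ = ⊥-elim (x≢y refl)
xor-≢-either false {x = false} {true}  _   b≡ = inj₂ b≡
xor-≢-either false {x = true}  {false} _   b≡ = inj₂ b≡
xor-≢-either false {x = true}  {true}  x≢y _ = ⊥-elim (x≢y refl)

HasInduced-nonconstant-switch⇒≤ : ∀ (G : Graph n) (H : Graph k) (c : Fin k → Bool) {d e} →
                                  MaxDegreeAtMost H d → MaxDegreeAtMost G e → HasInduced G (switch H c) →
                                  ∀ {u w} → c u ≢ c w → k ≤ (d + e) + (d + e)
HasInduced-nonconstant-switch⇒≤ G H c {d} {e} degH degG (h , h-inj , h-adj) {u} {w} cu≢cw =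
  AtMost-Universal⇒≤ covered (AtMost-∪ (Near-AtMost u) (Near-AtMost w))
  where
  Near : Fin _ → Pred (Fin _) 0ℓ
  Near x v = adj H x v ≡ true ⊎ adj G (h x) (h v) ≡ true

  Near-AtMost : ∀ x → AtMost (d + e) (Near x)
  Near-AtMost x = AtMost-∪ (degH x) (AtMost-preimage h h-inj (degG (h x)))

  ≢⇒Near : ∀ {x v} → c x ≢ c v → Near x v
  ≢⇒Near {x} {v} cx≢cv = xor-≢-either (adj H x v) cx≢cv (h-adj x v)

  covered : Universal (Near u ∪ Near w)
  covered v with c u ≟𝔹 c v
  ... | no cu≢cv  = inj₁ (≢⇒Near cu≢cv)
  ... | yes cu≡cv = inj₂ (≢⇒Near λ cw≡cv → cu≢cw (trans cu≡cv (sym cw≡cv)))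

Next : Fin n → Fin n → Set
Next {n} x y = toℕ y ≡ suc (toℕ x) ⊎ (suc (toℕ x) ≡ n × toℕ y ≡ 0)

Next-functional : ∀ {x y z : Fin n} → Next x y → Next x z → y ≡ z
Next-functional (inj₁ y≡1+x) (inj₁ z≡1+x) = toℕ-injective (trans y≡1+x (sym z≡1+x))
Next-functional {y = y} (inj₁ y≡1+x) (inj₂ (1+x≡n , _)) =
  ⊥-elim (<-irrefl (trans y≡1+x 1+x≡n) (toℕ<n y))
Next-functional {z = z} (inj₂ (1+x≡n , _)) (inj₁ z≡1+x) =
  ⊥-elim (<-irrefl (trans z≡1+x 1+x≡n) (toℕ<n z))
Next-functional (inj₂ (_ , y≡0)) (inj₂ (_ , z≡0)) = toℕ-injective (trans y≡0 (sym z≡0))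

Next-injective : ∀ {x y z : Fin n} → Next x z → Next y z → x ≡ y
Next-injective (inj₁ z≡1+x) (inj₁ z≡1+y) = toℕ-injective (suc-injective (trans (sym z≡1+x) z≡1+y))
Next-injective (inj₁ z≡1+x) (inj₂ (_ , z≡0)) with () ← trans (sym z≡1+x) z≡0
Next-injective (inj₂ (_ , z≡0)) (inj₁ z≡1+y) with () ← trans (sym z≡1+y) z≡0
Next-injective (inj₂ (1+x≡n , _)) (inj₂ (1+y≡n , _)) =
  toℕ-injective (suc-injective (trans 1+x≡n (sym 1+y≡n)))

Next-irreflexive : 2 ≤ n → ∀ {x : Fin n} → ¬ Next x x
Next-irreflexive _ {x} (inj₁ x≡1+x) = 1+n≢n (sym x≡1+x)
Next-irreflexive (s≤s (s≤s _)) (inj₂ (1+x≡n , x≡0)) with () ← trans (sym 1+x≡n) (cong suc x≡0)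

Next-asymmetric : 3 ≤ n → ∀ {x y : Fin n} → Next x y → Next y x → ⊥
Next-asymmetric _ {x} (inj₁ y≡1+x) (inj₁ x≡1+y) =
  <-irrefl (trans x≡1+y (cong suc y≡1+x)) (<-trans (n<1+n (toℕ x)) (n<1+n _))
Next-asymmetric (s≤s (s≤s (s≤s _))) (inj₁ y≡1+x) (inj₂ (1+y≡n , x≡0))
  with () ← trans (sym 1+y≡n) (cong suc (trans y≡1+x (cong suc x≡0)))
Next-asymmetric (s≤s (s≤s (s≤s _))) (inj₂ (1+x≡n , y≡0)) (inj₁ x≡1+y)
  with () ← trans (sym 1+x≡n) (cong suc (trans x≡1+y (cong suc y≡0)))
Next-asymmetric (s≤s (s≤s (s≤s _))) (inj₂ (_ , y≡0)) (inj₂ (1+y≡n , _))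
  with () ← trans (sym 1+y≡n) (cong suc y≡0)

Next-inject₁-suc : (x : Fin n) → Next (inject₁ x) (fsuc x)
Next-inject₁-suc x = inj₁ (cong suc (sym (toℕ-inject₁ x)))

Next-fromℕ-zero : Next (fromℕ n) fzero
Next-fromℕ-zero {n} = inj₂ (cong suc (toℕ-fromℕ n) , refl)

next : (x : Fin (suc n)) → ∃ (Next x)
next {zero}  fzero    = fzero , inj₂ (refl , refl)
next {suc n} fzero    = fsuc fzero , inj₁ refl
next {suc n} (fsuc x) with next x
... | y , inj₁ y≡1+x        = fsuc y , inj₁ (cong suc y≡1+x)
... | _ , inj₂ (1+x≡1+n , _) = fzero , inj₂ (cong suc 1+x≡1+n , refl)

previous : (x : Fin (suc n)) → ∃ λ y → Next y x
previous fzero    = fromℕ _ , Next-fromℕ-zero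
previous (fsuc x) = inject₁ x , Next-inject₁-suc x

cycStep⇒Next : (x y : Fin n) → T (cycStep x y) → Next x y ⊎ Next y x
cycStep⇒Next x y step with Equivalence.to T-∨ step
... | inj₁ 1+x≡y = inj₁ (inj₁ (sym (≡ᵇ⇒≡ _ _ 1+x≡y)))
... | inj₂ wrap with Equivalence.to T-∧ wrap
...   | x≡0 , 1+y≡n = inj₂ (inj₂ (≡ᵇ⇒≡ _ _ 1+y≡n , ≡ᵇ⇒≡ _ _ x≡0))

Cycle-adj⇒Next : ∀ {x y : Fin n} → adj (Cycle n) x y ≡ true → Next x y ⊎ Next y x
Cycle-adj⇒Next {x = x} {y} x~y
  with Equivalence.to T-∨ (proj₂ (Equivalence.to T-∧ (Equivalence.from T-≡ x~y)))
... | inj₁ x→y = cycStep⇒Next x y x→y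
... | inj₂ y→x = Sum.swap (cycStep⇒Next y x y→x)

Next⇒Cycle-adj : 2 ≤ n → ∀ {x y : Fin n} → Next x y → adj (Cycle n) x y ≡ true
Next⇒Cycle-adj 2≤n {x} {y} x→y = Equivalence.to T-≡ (Equivalence.from T-∧ (x≢y , adjacent x→y))
  where
  x≢y : T (not (does (x ≟ y)))
  x≢y = Equivalence.from T-not-≡ (dec-false (x ≟ y) (λ { refl → Next-irreflexive 2≤n x→y }))
  adjacent : Next x y → T (cycStep x y ∨ cycStep y x)
  adjacent (inj₁ y≡1+x) =
    Equivalence.from T-∨ (inj₁ (Equivalence.from T-∨ (inj₁ (≡⇒≡ᵇ _ _ (sym y≡1+x)))))
  adjacent (inj₂ (1+x≡n , y≡0)) = Equivalence.from (T-∨ {cycStep x y}) (inj₂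
    (Equivalence.from (T-∨ {does (suc (toℕ y) ≟ℕ toℕ x)}) (inj₂
      (Equivalence.from T-∧ (≡⇒≡ᵇ _ _ y≡0 , ≡⇒≡ᵇ _ _ 1+x≡n)))))

Cycle-maxDegree : ∀ n → MaxDegreeAtMost (Cycle n) 2
Cycle-maxDegree n x =
  AtMost-⊆ Cycle-adj⇒Next (AtMost-∪ (AtMost-1 Next-functional) (AtMost-1 Next-injective))

Next-closed⇒universal : {P : Pred (Fin n) ℓ} → (∀ {x y} → Next x y → P x → P y) →
                        ∀ {x} → P x → Universal P
Next-closed⇒universal {suc n} {P = P} closed {x} Px =
  <-weakInduction P (closed Next-fromℕ-zero P-fromℕ) (λ y → closed (Next-inject₁-suc y))
  where
  P-fromℕ : P (fromℕ n)
  P-fromℕ = <-weakInduction-startingFrom P Px (λ y → closed (Next-inject₁-suc y)) (≤fromℕ x)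

Cycle-HasInduced⇒≤ : 3 ≤ m → HasInduced (Cycle n) (Cycle m) → n ≤ m
Cycle-HasInduced⇒≤ {m = suc m} {n} 3≤m (h , h-inj , h-adj) = injective⇒≤ section-injective
  where
  Image : Pred (Fin n) 0ℓ
  Image y = ∃ λ u → h u ≡ y

  2≤m : 2 ≤ suc m
  2≤m = <⇒≤ 3≤m

  -- The two neighbours of u map to two distinct neighbours of h u, which cannot both precede it.
  image-closed : ∀ {y z} → Next y z → Image y → Image z
  image-closed y→z (u , refl) with next u | previous u
  ... | u⁺ , u→u⁺ | u⁻ , u⁻→u
    with Cycle-adj⇒Next (trans (h-adj u u⁺) (Next⇒Cycle-adj 2≤m u→u⁺))
       | Cycle-adj⇒Next (trans (h-adj u⁻ u) (Next⇒Cycle-adj 2≤m u⁻→u))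
  ... | inj₁ hu→hu⁺ | _           = u⁺ , Next-functional hu→hu⁺ y→z
  ... | _           | inj₂ hu→hu⁻ = u⁻ , Next-functional hu→hu⁻ y→z
  ... | inj₂ hu⁺→hu | inj₁ hu⁻→hu with h-inj (Next-injective hu⁻→hu hu⁺→hu)
  ...   | refl = ⊥-elim (Next-asymmetric 3≤m u→u⁺ u⁻→u)

  surjective : Universal Image
  surjective = Next-closed⇒universal image-closed (fzero , refl)

  section-injective : Injective _≡_ _≡_ (proj₁ ∘ surjective)
  section-injective {y} {z} eq =
    trans (sym (proj₂ (surjective y))) (trans (cong h eq) (proj₂ (surjective z)))

mainTheorem10 : ∀ (i j : ℕ) → 9 ≤ i → i < j →
    ∀ (n : ℕ) (G : Graph n) → SwitchingEquivalent (Cycle j) G → SFree (Cycle i) G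
mainTheorem10 i@(suc _) j 9≤i i<j n G Cj∼G k K Ci∼K G⊇K
  with SwitchingEquivalent-HasInduced (Cycle j) G (Cycle i) K Cj∼G Ci∼K G⊇K
... | c , Cj⊇SCic with constant-or-nonconstant c
...   | inj₁ constant = ≤⇒≯ (Cycle-HasInduced⇒≤ 3≤i Cj⊇Ci) i<j
  where
  3≤i : 3 ≤ i
  3≤i = ≤-trans (s≤s (s≤s (s≤s z≤n))) 9≤i
  Cj⊇Ci : HasInduced (Cycle j) (Cycle i)
  Cj⊇Ci = HasInduced-switch-constant (Cycle j) (Cycle i) constant Cj⊇SCic
...   | inj₂ (_ , c≢c0) = ≤⇒≯ i≤8 9≤i
  where
  i≤8 : i ≤ 8
  i≤8 = HasInduced-nonconstant-switch⇒≤ (Cycle j) (Cycle i) c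
          (Cycle-maxDegree i) (Cycle-maxDegree j) Cj⊇SCic c≢c0
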